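{- Let $\mathfrak S=(S,F,\leq)$ be a complete WSTS and $s_0\in S$. Then $Clover_{\mathfrak S}(s_0)$ is finite, and $cl(Cover_{\mathfrak S}(s_0))={\downarrow}Clover_{\mathfrak S}(s_0)$.
   Context: Poset notions: ${\downarrow}E=\{y\mid\exists x\in E, y\leq x\}$; $\mathrm{Max}\,E$ the maximal elements of $E$; directed set (nonempty, any two elements have an upper bound in it); dcpo (every directed $D$ has a sup $\bigvee D$); $y\ll x$ iff every directed $D$ with $\bigvee D\geq x$ has $z\in D$ with $y\leq z$; continuous dcpo: every $x$ is the directed sup of $\{y\mid y\ll x\}$; wpo: every infinite sequence has $i<j$ with $x_i\leq x_j$; dcwo: dcpo that is a wpo. Scott-open sets: upward-closed and meeting every directed set whose sup they contain; closed sets are complements; $cl(A)$ is the smallest closed set containing $A$. $\mathrm{Lub}(E)=\{\bigvee D\mid D\subseteq E\text{ directed}\}$. A complete WSTS is $(S,F,\leq)$ with $(S,\leq)$ a continuous dcwo and $F$ a finite set of partial continuous maps $S\to S$ (Scott-open domain, $f(\bigvee D)=\bigvee f(D)$ for directed $D\subseteq \mathrm{dom}f$); $s\to s'$ iff $s'=f(s)$ for some $f\in F$. $Cover_{\mathfrak S}(s_0)={\downarrow}Post^*_{\mathfrak S}({\downarrow}s_0)$ (states reachable from some state below $s_0$, then downward-closed); $Clover_{\mathfrak S}(s_0)=\mathrm{Max}\,\mathrm{Lub}(Cover_{\mathfrak S}(s_0))$. -}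

module Defs where

open import Level using (Level; _⊔_; suc)
open import Data.Nat using (ℕ; _<_)
open import Data.Maybe using (Maybe; just)
open import Data.List using (List)
open import Data.List.Relation.Unary.All using (All)
open import Data.List.Membership.Propositional renaming (_∈_ to _∈ᴸ_)
open import Data.Product using (Σ; ∃; ∃-syntax; _×_)
open import Relation.Nullary using (¬_)
open import Relation.Binary.Structures using (IsPartialOrder)
open import Relation.Binary.PropositionalEquality using (_≡_)
open import Relation.Binary.Construct.Closure.ReflexiveTransitive using (Star)

module Order {a r : Level} {S : Set a} (_≤_ : S → S → Set r) where

  ↓ : ∀ {p} → (S → Set p) → S → Set (a ⊔ r ⊔ p)
  ↓ E y = ∃[ x ] (E x × y ≤ x)

  Max : ∀ {p} → (S → Set p) → S → Set (a ⊔ r ⊔ p)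
  Max E x = E x × (∀ y → E y → x ≤ y → y ≡ x)

  Directed : ∀ {p} → (S → Set p) → Set (a ⊔ r ⊔ p)
  Directed D = (∃[ x ] D x) ×
               (∀ x y → D x → D y → ∃[ z ] (D z × x ≤ z × y ≤ z))

  IsSup : ∀ {p} → (S → Set p) → S → Set (a ⊔ r ⊔ p)
  IsSup D s = (∀ x → D x → x ≤ s) × (∀ u → (∀ x → D x → x ≤ u) → s ≤ u)

  IsDCPO : Set (suc (a ⊔ r))
  IsDCPO = (D : S → Set (a ⊔ r)) → Directed D → ∃[ s ] IsSup D s

  _≪_ : S → S → Set (suc (a ⊔ r))
  y ≪ x = (D : S → Set (a ⊔ r)) → Directed D → (s : S) → IsSup D s → x ≤ s →
          ∃[ z ] (D z × y ≤ z)

  IsContinuous : Set (suc (a ⊔ r))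
  IsContinuous = ∀ x → Directed (λ y → y ≪ x) × IsSup (λ y → y ≪ x) x

  IsWPO : Set (a ⊔ r)
  IsWPO = (x : ℕ → S) → ∃[ i ] ∃[ j ] (i < j × x i ≤ x j)

  UpwardClosed : ∀ {p} → (S → Set p) → Set (a ⊔ r ⊔ p)
  UpwardClosed U = ∀ x y → U x → x ≤ y → U y

  ScottOpen : ∀ {p} → (S → Set p) → Set (suc (a ⊔ r) ⊔ p)
  ScottOpen U = UpwardClosed U ×
    ((D : S → Set (a ⊔ r)) → Directed D → (s : S) → IsSup D s → U s →
      ∃[ x ] (D x × U x))

  ScottClosed : ∀ {p} → (S → Set p) → Set (suc (a ⊔ r) ⊔ p)
  ScottClosed C = ScottOpen (λ x → ¬ C x)

  cl : ∀ {p} → (S → Set p) → S → Set (suc (a ⊔ r) ⊔ p)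
  cl A x = (C : S → Set (a ⊔ r)) → ScottClosed C → (∀ y → A y → C y) → C x

  Lub : ∀ {p} → (S → Set p) → S → Set (suc (a ⊔ r) ⊔ p)
  Lub E s = Σ (S → Set (a ⊔ r)) λ D → ((∀ x → D x → E x) × Directed D × IsSup D s)

  -- partial maps S ⇀ S represented as S → Maybe S; dom f = {x | f x ≡ just _}
  dom : (S → Maybe S) → S → Set a
  dom f x = ∃[ y ] (f x ≡ just y)

  image : ∀ {p} → (S → Maybe S) → (S → Set p) → S → Set (a ⊔ p)
  image f D y = ∃[ x ] (D x × f x ≡ just y)

  PartialContinuous : (S → Maybe S) → Set (suc (a ⊔ r))
  PartialContinuous f = ScottOpen (dom f) ×
    ((D : S → Set (a ⊔ r)) → Directed D → (∀ x → D x → dom f x) →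
      (s : S) → IsSup D s → ∃[ t ] (f s ≡ just t × IsSup (image f D) t))

Finite : ∀ {a p} {S : Set a} → (S → Set p) → Set (a ⊔ p)
Finite {S = S} P = ∃[ xs ] (∀ (x : S) → (P x → x ∈ᴸ xs) × (x ∈ᴸ xs → P x))

record CompleteWSTS (a r : Level) : Set (suc (a ⊔ r)) where
  field
    S              : Set a
    _≤_            : S → S → Set r
    isPartialOrder : IsPartialOrder _≡_ _≤_
  open Order _≤_ public
  field
    isDCPO         : IsDCPO
    isContinuous   : IsContinuous
    isWPO          : IsWPO
    F              : List (S → Maybe S)
    F-continuous   : All PartialContinuous F

  Step : S → S → Set a
  Step s s' = ∃[ f ] (f ∈ᴸ F × f s ≡ just s')

  Post* : ∀ {p} → (S → Set p) → S → Set (a ⊔ p)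
  Post* A y = ∃[ x ] (A x × Star Step x y)

  Cover : S → S → Set (a ⊔ r)
  Cover s₀ = ↓ (Post* (↓ (λ x → x ≡ s₀)))

  Clover : S → S → Set (suc (a ⊔ r))
  Clover s₀ = Max (Lub (Cover s₀))

module Submission where

-- Only the dcwo structure of S matters: the statement holds for an arbitrary
-- subset A of a dcwo (here A = Cover(s₀)).  Reasoning classically:
--  * Call A finitely generated when finitely many sups of directed parts of A
--    dominate A.  Otherwise A is nonempty and not directed, so has x, y with
--    no common upper bound in A; then A = (A ∖ ↑x) ∪ (A ∖ ↑y) and one piece is
--    again not finitely generated.  Iterating gives x₀, x₁, … with xᵢ ≰ xⱼ for
--    i < j, contradicting well-quasi-ordering.
--  * A directed set below a finite list ms lies below one element of it; so
--    ↓ms is Scott-closed, and dominates Lub(A) when it dominates A.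
--  * If a finite ms ⊆ E dominates E, then Max E consists of the maximal
--    elements of ms: it is finite and ↓ms ⊆ ↓Max E.
--  * Scott-closed sets are down-closed and closed under directed sups, so
--    ↓Lub(A) ⊆ cl(A).  Altogether cl(A) ⊆ ↓ms ⊆ ↓Max Lub(A) ⊆ cl(A).

open import Defs
open import Level using (Level; _⊔_; suc; Lift; lift; lower)
open import Function using (id; _∘_)
open import Data.Product using (_×_; Σ; ∃; ∃-syntax; _,_; proj₁; proj₂)
open import Data.Empty using (⊥-elim)
open import Data.Nat using (ℕ; zero; _<_; _≤′_; ≤′-refl; ≤′-step) renaming (suc to 1+)
open import Data.Nat.Properties using (≤⇒≤′)
open import Data.List using (List; []; _∷_; _++_; filter)
open import Data.List.Relation.Unary.Any as Any using (Any; here; there)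
open import Data.List.Relation.Unary.All as All using (All; []; _∷_)
import Data.List.Relation.Unary.All.Properties as All
import Data.List.Relation.Unary.Any.Properties as Any
open import Data.List.Membership.Propositional using (_∈_; find; lose)
open import Data.List.Membership.Propositional.Properties using (∈-filter⁺; ∈-filter⁻)
open import Axiom.ExcludedMiddle using (ExcludedMiddle)
open import Axiom.DoubleNegationElimination using (DoubleNegationElimination; em⇒dne)
open import Relation.Nullary using (¬_; yes; no)
open import Relation.Nullary.Decidable using (map′)
open import Relation.Unary using (Pred; _⊆_; Decidable)
open import Relation.Binary.Structures using (IsPartialOrder)
open import Relation.Binary.PropositionalEquality using (_≡_; refl; trans; subst)

lowerEM : ∀ {ℓ} ℓ′ → ExcludedMiddle (ℓ ⊔ ℓ′) → ExcludedMiddle ℓ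
lowerEM ℓ′ em {P} = map′ lower lift (em {Lift ℓ′ P})

module PosetFacts {a r : Level} {S : Set a} {_≤_ : S → S → Set r}
  (isPartialOrder : IsPartialOrder _≡_ _≤_) (em : ExcludedMiddle (suc (a ⊔ r))) where

  open Order _≤_
  open IsPartialOrder isPartialOrder
    renaming (refl to ≤-refl; trans to ≤-trans; antisym to ≤-antisym)

  emᵣ : ExcludedMiddle r
  emᵣ = lowerEM (suc (a ⊔ r)) em

  em₀ : ExcludedMiddle (a ⊔ r)
  em₀ = lowerEM (suc (a ⊔ r)) em

  dne₀ : DoubleNegationElimination (a ⊔ r)
  dne₀ = em⇒dne em₀

  _≤Some_ : S → List S → Set (a ⊔ r)
  x ≤Some ms = Any (x ≤_) ms

  UpperBound : ∀ {p} → Pred S p → S → Set (a ⊔ r ⊔ p)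
  UpperBound D m = ∀ d → D d → d ≤ m

  _above_ : Pred S (a ⊔ r) → S → Pred S (a ⊔ r)
  (D above d₀) d = D d × d₀ ≤ d

  above-directed : ∀ {D d₀} → Directed D → D d₀ → Directed (D above d₀)
  above-directed {d₀ = d₀} (_ , join) d₀∈D =
    (d₀ , d₀∈D , ≤-refl) , λ x y (x∈D , d₀≤x) (y∈D , _) →
    let (z , z∈D , x≤z , y≤z) = join x y x∈D y∈D in z , (z∈D , ≤-trans d₀≤x x≤z) , x≤z , y≤z

  above-bound : ∀ {D d₀ m} → Directed D → D d₀ → UpperBound (D above d₀) m → UpperBound D m
  above-bound {d₀ = d₀} (_ , join) d₀∈D bound d d∈D =
    let (z , z∈D , d≤z , d₀≤z) = join d d₀ d∈D d₀∈D in ≤-trans d≤z (bound z (z∈D , d₀≤z))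

  not-bounded : ∀ {D : Pred S (a ⊔ r)} {m} → ¬ UpperBound D m → ∃[ d ] (D d × ¬ d ≤ m)
  not-bounded {D} {m} ¬bound = dne₀ λ none → ¬bound λ d d∈D → by-cases d d∈D none
    where
      by-cases : ∀ d → D d → ¬ (∃[ e ] (D e × ¬ e ≤ m)) → d ≤ m
      by-cases d d∈D none with emᵣ {d ≤ m}
      ... | yes d≤m = d≤m
      ... | no d≰m = ⊥-elim (none (d , d∈D , d≰m))

  -- A directed set lying in ↓ms lies below a single element of ms.
  -- (If D is not below the head m, restrict D above some d₀ ≰ m; that part
  -- avoids ↓m, and bounding it bounds D.)
  directed-below-one : ∀ ms (D : Pred S (a ⊔ r)) → Directed D →
    D ⊆ (_≤Some ms) → Any (UpperBound D) ms
  directed-below-one [] D ((d , d∈D) , _) D⊆ with D⊆ d∈D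
  ... | ()
  directed-below-one (m ∷ ms) D dirD D⊆ with em₀ {UpperBound D m}
  ... | yes D≤m = here D≤m
  ... | no D≰m = there (bound-by-tail (not-bounded D≰m))
    where
      bound-by-tail : ∃[ d₀ ] (D d₀ × ¬ d₀ ≤ m) → Any (UpperBound D) ms
      bound-by-tail (d₀ , d₀∈D , d₀≰m) = Any.map (above-bound dirD d₀∈D)
        (directed-below-one ms (D above d₀) (above-directed dirD d₀∈D) tail)
        where
          tail : (D above d₀) ⊆ (_≤Some ms)
          tail (d∈D , d₀≤d) with D⊆ d∈D
          ... | here d≤m = ⊥-elim (d₀≰m (≤-trans d₀≤d d≤m))
          ... | there d≤ms = d≤ms

  Lub-below : ∀ {p} {A : Pred S p} {ms} → A ⊆ (_≤Some ms) → Lub A ⊆ (_≤Some ms)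
  Lub-below {ms = ms} A⊆ (D , D⊆A , dirD , _ , least) =
    Any.map (least _) (directed-below-one ms D dirD (A⊆ ∘ D⊆A _))

  below-list-closed : ∀ ms → ScottClosed (_≤Some ms)
  below-list-closed ms = upward , inaccessible
    where
      upward : UpwardClosed (λ x → ¬ x ≤Some ms)
      upward x y x∉ x≤y y∈ = x∉ (Any.map (≤-trans x≤y) y∈)
      inaccessible : (D : Pred S (a ⊔ r)) → Directed D → (s : S) → IsSup D s →
        ¬ s ≤Some ms → ∃[ x ] (D x × ¬ x ≤Some ms)
      inaccessible D dirD s sup s∉ = dne₀ λ none →
        s∉ (Lub-below id (D , (λ x x∈D → dne₀ λ x∉ → none (x , x∈D , x∉)) , dirD , sup))

  closed-downward : ∀ {C : Pred S (a ⊔ r)} {x y} → ScottClosed C → x ≤ y → C y → C x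
  closed-downward (upward , _) x≤y y∈C = dne₀ λ x∉C → upward _ _ x∉C x≤y y∈C

  closed-sup : ∀ {C D : Pred S (a ⊔ r)} {s} → ScottClosed C → Directed D → D ⊆ C →
    IsSup D s → C s
  closed-sup (_ , inaccessible) dirD D⊆C sup = dne₀ λ s∉C →
    let (d , d∈D , d∉C) = inaccessible _ dirD _ sup s∉C in d∉C (D⊆C d∈D)

  ↓Lub⊆cl : ∀ {p} {A : Pred S p} → ↓ (Lub A) ⊆ cl A
  ↓Lub⊆cl (s , (D , D⊆A , dirD , sup) , x≤s) C closedC A⊆C =
    closed-downward closedC x≤s (closed-sup closedC dirD (λ d∈D → A⊆C _ (D⊆A _ d∈D)) sup)

  MaximalIn : List S → S → Set (a ⊔ r)
  MaximalIn ms c = c ∈ ms × (∀ {m} → m ∈ ms → c ≤ m → m ≡ c)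

  -- Prepending m to a list keeps an element x below a maximal element:
  -- either the old maximal c survives, or c ≤ m and m is maximal.
  maximal-cons : ∀ m {ms c x} → MaximalIn ms c → x ≤ c →
    ∃[ c′ ] (MaximalIn (m ∷ ms) c′ × x ≤ c′)
  maximal-cons m {c = c} (c∈ , c-max) x≤c with emᵣ {c ≤ m}
  ... | yes c≤m = m , (here refl , m-max) , ≤-trans x≤c c≤m
    where
      m-max : ∀ {m′} → m′ ∈ m ∷ _ → m ≤ m′ → m′ ≡ m
      m-max (here refl) _ = refl
      m-max (there m′∈) m≤m′ =
        let m′≡c = c-max m′∈ (≤-trans c≤m m≤m′) in
        trans m′≡c (≤-antisym c≤m (subst (m ≤_) m′≡c m≤m′))
  ... | no c≰m = c , (there c∈ , c-max′) , x≤c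
    where
      c-max′ : ∀ {m′} → m′ ∈ m ∷ _ → c ≤ m′ → m′ ≡ c
      c-max′ (here refl) c≤m = ⊥-elim (c≰m c≤m)
      c-max′ (there m′∈) c≤m′ = c-max m′∈ c≤m′

  below-maximal : ∀ ms {m} → m ∈ ms → ∃[ c ] (MaximalIn ms c × m ≤ c)
  below-maximal (m ∷ ms) (there m∈) =
    let (c , c-max , m≤c) = below-maximal ms m∈ in maximal-cons m c-max m≤c
  below-maximal (m ∷ ms) (here refl) with em₀ {m ≤Some ms}
  ... | yes m≤ms =
    let (m′ , m′∈ , m≤m′) = find m≤ms
        (c , c-max , m′≤c) = below-maximal ms m′∈
    in maximal-cons m c-max (≤-trans m≤m′ m′≤c)
  ... | no m≰ms = m , (here refl , m-max) , ≤-refl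
    where
      m-max : ∀ {m′} → m′ ∈ m ∷ ms → m ≤ m′ → m′ ≡ m
      m-max (here refl) _ = refl
      m-max (there m′∈) m≤m′ = ⊥-elim (m≰ms (lose m′∈ m≤m′))

  module FiniteDominated (E : Pred S (suc (a ⊔ r))) (ms : List S)
    (ms⊆E : All E ms) (E⊆↓ms : E ⊆ (_≤Some ms)) where

    Max⊆ms : Max E ⊆ (_∈ ms)
    Max⊆ms (c∈E , c-max) =
      let (m , m∈ , c≤m) = find (E⊆↓ms c∈E) in
      subst (_∈ ms) (c-max m (All.lookup ms⊆E m∈) c≤m) m∈

    MaximalIn⇒Max : MaximalIn ms ⊆ Max E
    MaximalIn⇒Max (c∈ , c-max) = All.lookup ms⊆E c∈ , λ y y∈E c≤y →
      let (m , m∈ , y≤m) = find (E⊆↓ms y∈E)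
          m≡c = c-max m∈ (≤-trans c≤y y≤m)
      in ≤-antisym (subst (y ≤_) m≡c y≤m) c≤y

    Max? : Decidable (Max E)
    Max? x = em

    Max-finite : Finite (Max E)
    Max-finite = filter Max? ms , λ x →
      (λ c-max → ∈-filter⁺ Max? (Max⊆ms c-max) c-max) ,
      (λ x∈ → proj₂ (∈-filter⁻ Max? {xs = ms} x∈))

    ↓ms⊆↓Max : (_≤Some ms) ⊆ ↓ (Max E)
    ↓ms⊆↓Max x≤ms =
      let (m , m∈ , x≤m) = find x≤ms
          (c , c-max , m≤c) = below-maximal ms m∈
      in c , MaximalIn⇒Max c-max , ≤-trans x≤m m≤c

module DCWOFacts {a r : Level} {S : Set a} {_≤_ : S → S → Set r}
  (isPartialOrder : IsPartialOrder _≡_ _≤_) (em : ExcludedMiddle (suc (a ⊔ r)))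
  (isDCPO : Order.IsDCPO _≤_) (isWPO : Order.IsWPO _≤_) where

  open Order _≤_
  open PosetFacts isPartialOrder em

  FinitelyGenerated : Pred S (a ⊔ r) → Set (suc (a ⊔ r))
  FinitelyGenerated A = ∃[ ms ] (All (Lub A) ms × A ⊆ (_≤Some ms))

  Lub-mono : ∀ {p q} {A : Pred S p} {B : Pred S q} → A ⊆ B → Lub A ⊆ Lub B
  Lub-mono A⊆B (D , D⊆A , dirD , sup) = D , (λ x x∈D → A⊆B (D⊆A x x∈D)) , dirD , sup

  _∖↑_ : Pred S (a ⊔ r) → S → Pred S (a ⊔ r)
  (A ∖↑ x) z = A z × ¬ x ≤ z

  fg-empty : ∀ {A} → ¬ ∃ A → FinitelyGenerated A
  fg-empty empty = [] , [] , λ {x} x∈A → ⊥-elim (empty (x , x∈A))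

  fg-directed : ∀ {A} → Directed A → FinitelyGenerated A
  fg-directed {A} dirA =
    let (s , sup) = isDCPO A dirA in
    s ∷ [] , (A , (λ _ → id) , dirA , sup) ∷ [] , λ x∈A → here (proj₁ sup _ x∈A)

  -- If x, y ∈ A have no common upper bound in A, then A = (A ∖↑ x) ∪ (A ∖↑ y);
  -- so A is finitely generated once both pieces are.
  fg-split : ∀ {A} x y → ¬ (∃[ z ] (A z × x ≤ z × y ≤ z)) →
    FinitelyGenerated (A ∖↑ x) → FinitelyGenerated (A ∖↑ y) → FinitelyGenerated A
  fg-split {A} x y no-bound (ms₁ , lub₁ , A₁⊆) (ms₂ , lub₂ , A₂⊆) =
    ms₁ ++ ms₂ , All.++⁺ (All.map (Lub-mono proj₁) lub₁) (All.map (Lub-mono proj₁) lub₂) , cover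
    where
      cover : A ⊆ (_≤Some (ms₁ ++ ms₂))
      cover {z} z∈A with emᵣ {x ≤ z} | emᵣ {y ≤ z}
      ... | no x≰z | _ = Any.++⁺ˡ (A₁⊆ (z∈A , x≰z))
      ... | yes _ | no y≰z = Any.++⁺ʳ ms₁ (A₂⊆ (z∈A , y≰z))
      ... | yes x≤z | yes y≤z = ⊥-elim (no-bound (z , z∈A , x≤z , y≤z))

  unbounded-pair : ∀ {A : Pred S (a ⊔ r)} → ∃ A → ¬ Directed A →
    ∃[ x ] ∃[ y ] (A x × A y × ¬ (∃[ z ] (A z × x ≤ z × y ≤ z)))
  unbounded-pair nonempty ¬dir = dne₀ λ none →
    ¬dir (nonempty , λ x y x∈A y∈A → dne₀ λ ¬ub → none (x , y , x∈A , y∈A , ¬ub))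

  shrink : ∀ A → ¬ FinitelyGenerated A → ∃[ x ] (A x × ¬ FinitelyGenerated (A ∖↑ x))
  shrink A ¬fg = choose (unbounded-pair nonempty (¬fg ∘ fg-directed))
    where
      nonempty : ∃ A
      nonempty = dne₀ (¬fg ∘ fg-empty)
      choose : ∃[ x ] ∃[ y ] (A x × A y × ¬ (∃[ z ] (A z × x ≤ z × y ≤ z))) →
        ∃[ x ] (A x × ¬ FinitelyGenerated (A ∖↑ x))
      choose (x , y , x∈A , y∈A , no-bound) with em {FinitelyGenerated (A ∖↑ x)}
      ... | no ¬fgx = x , x∈A , ¬fgx
      ... | yes fgx = y , y∈A , λ fgy → ¬fg (fg-split x y no-bound fgx fgy)

  module BadSequence (A₀ : Pred S (a ⊔ r)) (¬fg₀ : ¬ FinitelyGenerated A₀) where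

    NonGenerated : Set (suc (a ⊔ r))
    NonGenerated = Σ (Pred S (a ⊔ r)) (λ A → ¬ FinitelyGenerated A)

    next : NonGenerated → NonGenerated
    next (A , ¬fg) = A ∖↑ proj₁ (shrink A ¬fg) , proj₂ (proj₂ (shrink A ¬fg))

    stage : ℕ → NonGenerated
    stage zero = A₀ , ¬fg₀
    stage (1+ n) = next (stage n)

    point : ℕ → S
    point n = proj₁ (shrink (proj₁ (stage n)) (proj₂ (stage n)))

    point∈stage : ∀ n → proj₁ (stage n) (point n)
    point∈stage n = proj₁ (proj₂ (shrink (proj₁ (stage n)) (proj₂ (stage n))))

    decreasing : ∀ {m n} → m ≤′ n → proj₁ (stage n) ⊆ proj₁ (stage m)
    decreasing ≤′-refl = id
    decreasing (≤′-step m≤n) = decreasing m≤n ∘ proj₁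

    -- Since xⱼ ∈ Aⱼ ⊆ Aᵢ₊₁ = Aᵢ ∖↑ xᵢ, the sequence of points is bad.
    bad : ∀ {i j} → i < j → ¬ point i ≤ point j
    bad {j = j} i<j = proj₂ (decreasing (≤⇒≤′ i<j) (point∈stage j))

  finitely-generated : ∀ A → FinitelyGenerated A
  finitely-generated A = em⇒dne em λ ¬fg →
    let open BadSequence A ¬fg
        (i , j , i<j , xᵢ≤xⱼ) = isWPO point
    in bad i<j xᵢ≤xⱼ

  -- A generating list ms gives
  -- cl A ⊆ ↓ms (a closed set containing A) ⊆ ↓Max Lub(A) ⊆ ↓Lub(A) ⊆ cl A.
  clover-theorem : (A : Pred S (a ⊔ r)) →
    Finite (Max (Lub A)) × (cl A ⊆ ↓ (Max (Lub A))) × (↓ (Max (Lub A)) ⊆ cl A)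
  clover-theorem A =
    Max-finite ,
    (λ x∈clA → ↓ms⊆↓Max (x∈clA (_≤Some ms) (below-list-closed ms) (λ _ → A⊆↓ms))) ,
    (λ (c , c-max , x≤c) → ↓Lub⊆cl (c , proj₁ c-max , x≤c))
    where
      ms : List S
      ms = proj₁ (finitely-generated A)
      A⊆↓ms : A ⊆ (_≤Some ms)
      A⊆↓ms = proj₂ (proj₂ (finitely-generated A))
      open FiniteDominated (Lub A) ms (proj₁ (proj₂ (finitely-generated A))) (Lub-below A⊆↓ms)

proposition3p7 : ∀ {a r : Level} → ExcludedMiddle (suc (a ⊔ r)) →
    (𝔖 : CompleteWSTS a r) → let open CompleteWSTS 𝔖 in
    (s₀ : S) →
    Finite (Clover s₀) ×
    ((∀ x → cl (Cover s₀) x → ↓ (Clover s₀) x) ×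
     (∀ x → ↓ (Clover s₀) x → cl (Cover s₀) x))
proposition3p7 em 𝔖 s₀ =
  let (finite , cl⊆↓Clover , ↓Clover⊆cl) = clover-theorem (Cover s₀)
  in finite , (λ _ → cl⊆↓Clover) , (λ _ → ↓Clover⊆cl)
  where
    open CompleteWSTS 𝔖
    open DCWOFacts isPartialOrder em isDCPO isWPO using (clover-theorem)
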